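{- For every integer $n\ge 2$, the strong hub cover pebbling number of the book graph $B_n$ satisfies $h_s^*(B_n)=2n+3$.
   Context: All graphs are finite, simple and connected. For $n\ge 2$, the star $S_n$ is the graph on $n+1$ vertices obtained by joining $n$ pairwise nonadjacent vertices to a single universal vertex. The book $B_n$ is the Cartesian product $S_n\,\square\, P_2$ on $2n+2$ vertices; explicitly, it has vertices $a,b,u_1,\dots,u_n,v_1,\dots,v_n$ with edges $au_i$, $bv_i$, $u_iv_i$ for $1\le i\le n$, and $ab$. A configuration of pebbles assigns a nonnegative integer number of pebbles to each vertex. A pebbling move consists of choosing adjacent vertices $u,v$ where $u$ has at least two pebbles, removing two pebbles from $u$ and adding one pebble to $v$. A nonempty vertex set $U$ of a graph $G$ is a strong hub set if for any two vertices of $G$ there is a path between them all of whose internal vertices lie in $U$ (a path with no internal vertices qualifies). The strong hub cover pebbling number $h_s^*(G)$ is the smallest integer $t$ such that for every configuration with $t$ pebbles on $G$, one can perform a sequence of pebbling moves after which there is a strong hub set $U$ with every vertex of $U$ having at least one pebble. -}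

module Defs where

open import Data.Nat using (ℕ; zero; suc; _+_; _∸_; _≤_; _<_)
open import Data.Fin using (Fin)
import Data.Fin as Fin
open import Data.Bool using (Bool; T)
open import Data.List using (List; []; _∷_)
open import Data.List.Relation.Unary.All using (All)
open import Data.List.Relation.Unary.Unique.Propositional using (Unique)
open import Data.Product using (Σ; ∃; ∃-syntax; _×_; _,_)
open import Relation.Nullary using (¬_; Dec; yes; no)
open import Relation.Binary.PropositionalEquality using (_≡_; _≢_; refl; cong)
open import Relation.Binary.Construct.Closure.ReflexiveTransitive using (Star)

data V (n : ℕ) : Set where
  a b : V n
  u v : Fin n → V n

data Adj {n : ℕ} : V n → V n → Set where
  au : (i : Fin n) → Adj a (u i)
  ua : (i : Fin n) → Adj (u i) a
  bv : (i : Fin n) → Adj b (v i)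
  vb : (i : Fin n) → Adj (v i) b
  uv : (i : Fin n) → Adj (u i) (v i)
  vu : (i : Fin n) → Adj (v i) (u i)
  ab : Adj a b
  ba : Adj b a

_≟V_ : {n : ℕ} (x y : V n) → Dec (x ≡ y)
a ≟V a = yes refl
a ≟V b = no λ ()
a ≟V u _ = no λ ()
a ≟V v _ = no λ ()
b ≟V a = no λ ()
b ≟V b = yes refl
b ≟V u _ = no λ ()
b ≟V v _ = no λ ()
u _ ≟V a = no λ ()
u _ ≟V b = no λ ()
u i ≟V u j with i Fin.≟ j
... | yes refl = yes refl
... | no i≢j = no λ { refl → i≢j refl }
u _ ≟V v _ = no λ ()
v _ ≟V a = no λ ()
v _ ≟V b = no λ ()
v _ ≟V u _ = no λ ()
v i ≟V v j with i Fin.≟ j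
... | yes refl = yes refl
... | no i≢j = no λ { refl → i≢j refl }

Config : ℕ → Set
Config n = V n → ℕ

sumFin : {n : ℕ} → (Fin n → ℕ) → ℕ
sumFin {zero} f = 0
sumFin {suc n} f = f Fin.zero + sumFin (λ i → f (Fin.suc i))

size : {n : ℕ} → Config n → ℕ
size c = c a + c b + sumFin (λ i → c (u i)) + sumFin (λ i → c (v i))

moveResult : {n : ℕ} → Config n → V n → V n → Config n
moveResult c x y z with z ≟V x | z ≟V y
... | yes _ | _     = c z ∸ 2
... | no _  | yes _ = suc (c z)
... | no _  | no _  = c z

Move : {n : ℕ} → Config n → Config n → Set
Move c c' = ∃[ x ] ∃[ y ] (Adj x y × 2 ≤ c x × (∀ z → c' z ≡ moveResult c x y z))

Reachable : {n : ℕ} → Config n → Config n → Set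
Reachable = Star Move

-- a walk x = w_0, w_1, ..., w_k, w_{k+1} = y, indexed by its internal vertices w_1..w_k
data Walk {n : ℕ} : V n → V n → List (V n) → Set where
  edge : {x y : V n} → Adj x y → Walk x y []
  step : {x z y : V n} {is : List (V n)} → Adj x z → Walk z y is → Walk x y (z ∷ is)

Path : {n : ℕ} → V n → V n → List (V n) → Set
Path x y is = Walk x y is × Unique (x ∷ y ∷ is)

IsStrongHubSet : {n : ℕ} → (V n → Bool) → Set
IsStrongHubSet {n} U =
  (∃[ w ] T (U w)) ×
  (∀ (x y : V n) → x ≢ y → ∃[ is ] (Path x y is × All (λ z → T (U z)) is))

HubCoverSolvable : {n : ℕ} → Config n → Set
HubCoverSolvable {n} c =
  ∃[ c' ] (Reachable c c' × ∃[ U ] (IsStrongHubSet U × (∀ z → T (U z) → 1 ≤ c' z)))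

AllSolvable : ℕ → ℕ → Set
AllSolvable n t = (c : Config n) → size c ≡ t → HubCoverSolvable c

IsStrongHubCoverPebblingNumberOfBook : ℕ → ℕ → Set
IsStrongHubCoverPebblingNumberOfBook n t =
  AllSolvable n t × (∀ t' → t' < t → ¬ AllSolvable n t')

-- Upper bound: the hub sets {a, b}, {a} ∪ {uᵢ} and {b} ∪ {vᵢ} suffice.  With 2n+3 pebbles, a
-- few moves towards a (or, symmetrically, b) cover both a and b unless every uᵢ and vᵢ holds at
-- most one pebble, a holds exactly two and b none; then 2n+1 ≤ 2 + Σ uᵢ + Σ vᵢ forces one page
-- to be fully covered, giving {a} ∪ {uᵢ} directly or {b} ∪ {vᵢ} after the move a → b.
--
-- Lower bound (indices from 0): a strong hub set contains a or both b and v₁, since it joins u₀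
-- to u₁, and it contains b or both a and u₀, since it joins v₁ to v₀.  Weight a pebble on a, b,
-- u₀, v₀, v₁ by 4, 2, 2, 1, 4 and a pair of pebbles on any other uᵢ or vᵢ by 4.  No move
-- increases the total weight, and covering such a hub set costs at least 6.  Five pebbles on v₀
-- and one on every uᵢ (i ≥ 1) and vᵢ (i ≥ 2) are 2n+2 pebbles of weight 5, and removing pebbles
-- keeps the weight at most 5.

{-# OPTIONS --safe #-}
module Submission where

open import Defs
open import Data.Nat using (ℕ; zero; suc; _+_; _*_; _∸_; _≤_; _<_; z≤n; s≤s; ⌊_/2⌋; _≤?_)
open import Data.Nat.Properties
open import Data.Nat.Tactic.RingSolver using (solve-∀)
open import Algebra.Properties.CommutativeSemigroup +-commutativeSemigroup using (xy∙z≈xz∙y; xy∙z≈zy∙x; x∙yz≈xz∙y)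
open import Data.Fin using (Fin; zero; suc)
import Data.Fin as Fin
import Data.Fin.Properties as Finₚ
open import Data.Bool using (Bool; true; false; T)
open import Data.Unit using (tt)
open import Data.Empty using (⊥-elim)
open import Data.List using (List; []; _∷_; map)
open import Data.List.Relation.Unary.All as All using (All; []; _∷_)
import Data.List.Relation.Unary.All.Properties as Allₚ
open import Data.List.Relation.Unary.Any using (here; there)
open import Data.List.Relation.Unary.AllPairs using ([]; _∷_)
import Data.List.Relation.Unary.Unique.Propositional.Properties as Uniqueₚ
open import Data.List.Membership.Propositional using (_∈_)
open import Data.Product as Product using (∃-syntax; _×_; _,_)
open import Data.Sum as Sum using (_⊎_; inj₁; inj₂)
open import Function using (_∘_)
open import Relation.Nullary using (¬_; yes; no)
open import Relation.Binary.PropositionalEquality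
open import Relation.Binary.Construct.Closure.ReflexiveTransitive using (ε; _◅_; gmap)

private
  variable
    n m k l t p q p′ q′ : ℕ
    i j : Fin n
    x y z : V n
    c c′ d : Config n
    F G : V n → ℕ
    α β : V n → ℕ
    U : V n → Bool

+-positive : ∀ m → 0 < m + n → 0 < m ⊎ 0 < n
+-positive zero    pos = inj₂ pos
+-positive (suc m) _   = inj₁ (s≤s z≤n)

sumFin-cong : {f g : Fin n → ℕ} → (∀ i → f i ≡ g i) → sumFin f ≡ sumFin g
sumFin-cong {n = zero}  f≗g = refl
sumFin-cong {n = suc n} f≗g = cong₂ _+_ (f≗g zero) (sumFin-cong (f≗g ∘ suc))

sumFin-update : {f g : Fin n → ℕ} (j : Fin n) → (∀ i → i ≢ j → f i ≡ g i) →
                sumFin f + g j ≡ sumFin g + f j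
sumFin-update {f = f} {g} zero f≗g = begin
  f zero + sumFin (f ∘ suc) + g zero  ≡⟨ cong (λ s → f zero + s + g zero) (sumFin-cong tails) ⟩
  f zero + sumFin (g ∘ suc) + g zero  ≡⟨ xy∙z≈zy∙x (f zero) _ (g zero) ⟩
  g zero + sumFin (g ∘ suc) + f zero  ∎
  where
  open ≡-Reasoning
  tails : ∀ i → f (suc i) ≡ g (suc i)
  tails i = f≗g (suc i) λ ()
sumFin-update {f = f} {g} (suc j) f≗g = begin
  f zero + sumFin (f ∘ suc) + g (suc j)    ≡⟨ +-assoc (f zero) _ _ ⟩
  f zero + (sumFin (f ∘ suc) + g (suc j))  ≡⟨ cong₂ _+_ (f≗g zero λ ()) (sumFin-update j tails) ⟩
  g zero + (sumFin (g ∘ suc) + f (suc j))  ≡⟨ +-assoc (g zero) _ _ ⟨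
  g zero + sumFin (g ∘ suc) + f (suc j)    ∎
  where
  open ≡-Reasoning
  tails : ∀ i → i ≢ j → f (suc i) ≡ g (suc i)
  tails i i≢j = f≗g (suc i) (i≢j ∘ Finₚ.suc-injective)

sumFin-mono : {f g : Fin n → ℕ} → (∀ i → f i ≤ g i) → sumFin f ≤ sumFin g
sumFin-mono {n = zero}  f≤g = z≤n
sumFin-mono {n = suc n} f≤g = +-mono-≤ (f≤g zero) (sumFin-mono (f≤g ∘ suc))

sumFin-const : ∀ n k → sumFin {n} (λ _ → k) ≡ n * k
sumFin-const zero    k = refl
sumFin-const (suc n) k = cong (k +_) (sumFin-const n k)

sumFin-positive : {f : Fin n → ℕ} → 0 < sumFin f → ∃[ i ] 0 < f i
sumFin-positive {n = zero} ()
sumFin-positive {n = suc n} {f = f} pos with +-positive (f zero) pos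
... | inj₁ pos₀ = zero , pos₀
... | inj₂ pos₁ = let i , posᵢ = sumFin-positive pos₁ in suc i , posᵢ

Light : (Fin n → ℕ) → Set
Light f = ∀ i → f i ≤ 1

sumFin-light : {f : Fin n → ℕ} → Light f → sumFin f ≤ n
sumFin-light {n = zero}  _   = z≤n
sumFin-light {n = suc n} f≤1 = +-mono-≤ (f≤1 zero) (sumFin-light (f≤1 ∘ suc))

sumFin-full : {f : Fin n → ℕ} → Light f → n ≤ sumFin f → ∀ i → 1 ≤ f i
sumFin-full {n = suc n} {f = f} f≤1 full zero =
  +-cancelʳ-≤ n 1 (f zero) (≤-trans full (+-monoʳ-≤ (f zero) (sumFin-light (f≤1 ∘ suc))))
sumFin-full {n = suc n} {f = f} f≤1 full (suc i) =
  sumFin-full (f≤1 ∘ suc) (+-cancelˡ-≤ 1 n _ (≤-trans full (+-monoˡ-≤ _ (f≤1 zero)))) i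

u≢u : i ≢ j → u i ≢ u j
u≢u i≢j refl = i≢j refl

v≢v : i ≢ j → v i ≢ v j
v≢v i≢j refl = i≢j refl

Σu Σv : (V n → ℕ) → ℕ
Σu F = sumFin (F ∘ u)
Σv F = sumFin (F ∘ v)

size-mono : (∀ z → F z ≤ G z) → size F ≤ size G
size-mono F≤G =
  +-mono-≤ (+-mono-≤ (+-mono-≤ (F≤G a) (F≤G b)) (sumFin-mono (F≤G ∘ u))) (sumFin-mono (F≤G ∘ v))

size-update : (x : V n) → (∀ z → z ≢ x → F z ≡ G z) → size F + G x ≡ size G + F x
size-update {F = F} {G} a F≗G
  rewrite F≗G b (λ ()) | sumFin-cong (λ i → F≗G (u i) λ ()) | sumFin-cong (λ i → F≗G (v i) λ ())
  = exchange (F a) (G b) _ _ (G a)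
  where
  exchange : ∀ p q r s t → p + q + r + s + t ≡ t + q + r + s + p
  exchange = solve-∀
size-update {F = F} {G} b F≗G
  rewrite F≗G a (λ ()) | sumFin-cong (λ i → F≗G (u i) λ ()) | sumFin-cong (λ i → F≗G (v i) λ ())
  = exchange (G a) (F b) _ _ (G b)
  where
  exchange : ∀ p q r s t → p + q + r + s + t ≡ p + t + r + s + q
  exchange = solve-∀
size-update {F = F} {G} (u j) F≗G
  rewrite F≗G a (λ ()) | F≗G b (λ ()) | sumFin-cong (λ i → F≗G (v i) λ ()) = begin
    G a + G b + Σu F + Σv G + G (u j)    ≡⟨ regroup (G a + G b) _ _ _ ⟩
    G a + G b + (Σu F + G (u j)) + Σv G  ≡⟨ cong (λ s → G a + G b + s + Σv G) (sumFin-update j agree) ⟩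
    G a + G b + (Σu G + F (u j)) + Σv G  ≡⟨ regroup (G a + G b) _ _ _ ⟨
    G a + G b + Σu G + Σv G + F (u j)    ∎
  where
  open ≡-Reasoning
  agree : ∀ i → i ≢ j → F (u i) ≡ G (u i)
  agree i i≢j = F≗G (u i) (u≢u i≢j)
  regroup : ∀ p r s t → p + r + s + t ≡ p + (r + t) + s
  regroup = solve-∀
size-update {F = F} {G} (v j) F≗G
  rewrite F≗G a (λ ()) | F≗G b (λ ()) | sumFin-cong (λ i → F≗G (u i) λ ()) = begin
    G a + G b + Σu G + Σv F + G (v j)    ≡⟨ +-assoc (G a + G b + Σu G) _ _ ⟩
    G a + G b + Σu G + (Σv F + G (v j))  ≡⟨ cong (G a + G b + Σu G +_) (sumFin-update j agree) ⟩
    G a + G b + Σu G + (Σv G + F (v j))  ≡⟨ +-assoc (G a + G b + Σu G) _ _ ⟨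
    G a + G b + Σu G + Σv G + F (v j)    ∎
  where
  open ≡-Reasoning
  agree : ∀ i → i ≢ j → F (v i) ≡ G (v i)
  agree i i≢j = F≗G (v i) (v≢v i≢j)

_[_≔_] : (V n → ℕ) → V n → ℕ → V n → ℕ
(F [ x ≔ k ]) z with z ≟V x
... | yes _ = k
... | no _  = F z

≔-same : (F [ x ≔ k ]) x ≡ k
≔-same {x = x} with x ≟V x
... | yes _   = refl
... | no x≢x = ⊥-elim (x≢x refl)

≔-other : z ≢ x → (F [ x ≔ k ]) z ≡ F z
≔-other {z = z} {x = x} z≢x with z ≟V x
... | yes z≡x = ⊥-elim (z≢x z≡x)
... | no _    = refl

≔-≤ : k ≤ F x → ∀ z → (F [ x ≔ k ]) z ≤ F z
≔-≤ {x = x} k≤Fx z with z ≟V x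
... | yes refl = k≤Fx
... | no _     = ≤-refl

size-≔ : (x : V n) → size (F [ x ≔ k ]) + F x ≡ size F + k
size-≔ {F = F} {k = k} x =
  trans (size-update {F = F [ x ≔ k ]} {G = F} x λ z z≢x → ≔-other {F = F} z≢x)
        (cong (size F +_) (≔-same {F = F} {x = x} {k = k}))

size-update₂ : x ≢ y → (∀ z → z ≢ x → z ≢ y → F z ≡ G z) →
               size F + G x + G y ≡ size G + F x + F y
size-update₂ {x = x} {y} {F = F} {G} x≢y F≗G = begin
  size F + G x + G y  ≡⟨ cong (λ w → size F + w + G y) (≔-same {F = F} {x = x}) ⟨
  size F + H x + G y  ≡⟨ cong (_+ G y) (size-update x F≗H) ⟩
  size H + F x + G y  ≡⟨ xy∙z≈xz∙y (size H) _ _ ⟩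
  size H + G y + F x  ≡⟨ cong (_+ F x) (size-update y H≗G) ⟩
  size G + H y + F x  ≡⟨ cong (λ w → size G + w + F x) (≔-other {F = F} (≢-sym x≢y)) ⟩
  size G + F y + F x  ≡⟨ xy∙z≈xz∙y (size G) _ _ ⟩
  size G + F x + F y  ∎
  where
  open ≡-Reasoning
  H : V _ → ℕ
  H = F [ x ≔ G x ]
  F≗H : ∀ z → z ≢ x → F z ≡ H z
  F≗H z z≢x = sym (≔-other {F = F} z≢x)
  H≗G : ∀ z → z ≢ y → H z ≡ G z
  H≗G z z≢y with z ≟V x
  ... | yes refl = refl
  ... | no z≢x   = F≗G z z≢x z≢y

size-pair : x ≢ y → F x + F y ≤ size F
size-pair {x = x} {y} {F = F} x≢y = begin
  F x + F y              ≡⟨ +-comm (F x) (F y) ⟩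
  F y + F x              ≤⟨ m≤n+m _ (size F₂) ⟩
  size F₂ + (F y + F x)  ≡⟨ +-assoc (size F₂) _ _ ⟨
  size F₂ + F y + F x    ≡⟨ cong (λ w → size F₂ + w + F x) (≔-other {F = F} (≢-sym x≢y)) ⟨
  size F₂ + F₁ y + F x   ≡⟨ cong (_+ F x) (trans (size-≔ y) (+-identityʳ (size F₁))) ⟩
  size F₁ + F x          ≡⟨ trans (size-≔ x) (+-identityʳ (size F)) ⟩
  size F                 ∎
  where
  open ≤-Reasoning
  F₁ F₂ : V _ → ℕ
  F₁ = F [ x ≔ 0 ]
  F₂ = F₁ [ y ≔ 0 ]

size-remove : 0 < c x → size c ≡ suc (size (c [ x ≔ c x ∸ 1 ]))
size-remove {c = c} {x = x} 0<cx = +-cancelʳ-≡ (c x ∸ 1) _ _ (begin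
  size c + (c x ∸ 1)            ≡⟨ size-≔ x ⟨
  size c₁ + c x                 ≡⟨ cong (size c₁ +_) (m+[n∸m]≡n 0<cx) ⟨
  size c₁ + suc (c x ∸ 1)       ≡⟨ +-suc (size c₁) _ ⟩
  suc (size c₁) + (c x ∸ 1)     ∎)
  where
  open ≡-Reasoning
  c₁ : Config _
  c₁ = c [ x ≔ c x ∸ 1 ]

occupied : 0 < size c → ∃[ x ] 0 < c x
occupied {c = c} pos with +-positive (c a + c b + Σu c) pos
... | inj₂ pos-v = let i , posᵢ = sumFin-positive pos-v in v i , posᵢ
... | inj₁ pos₁ with +-positive (c a + c b) pos₁
... | inj₂ pos-u = let i , posᵢ = sumFin-positive pos-u in u i , posᵢ
... | inj₁ pos₂ with +-positive (c a) pos₂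
... | inj₁ pos-a = a , pos-a
... | inj₂ pos-b = b , pos-b

shrink : (c : Config n) → t ≤ size c → ∃[ c′ ] ((∀ z → c′ z ≤ c z) × size c′ ≡ t)
shrink {n = n} {t = t} c t≤size = go (size c ∸ t) c (m∸n+n≡m t≤size)
  where
  go : ∀ d (c : Config n) → d + t ≡ size c → ∃[ c′ ] ((∀ z → c′ z ≤ c z) × size c′ ≡ t)
  go zero    c t≡size = c , (λ _ → ≤-refl) , sym t≡size
  go (suc d) c size≡  with occupied (subst (0 <_) size≡ (s≤s z≤n))
  ... | x , 0<cx with go d (c [ x ≔ c x ∸ 1 ]) (suc-injective (trans size≡ (size-remove {c = c} {x = x} 0<cx)))
  ... | c′ , c′≤ , size≡t =
    c′ , (λ z → ≤-trans (c′≤ z) (≔-≤ {F = c} {x = x} (m∸n≤m (c x) 1) z)) , size≡t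

adj≢ : Adj x y → x ≢ y
adj≢ (au _) ()
adj≢ (ua _) ()
adj≢ (bv _) ()
adj≢ (vb _) ()
adj≢ (uv _) ()
adj≢ (vu _) ()
adj≢ ab ()
adj≢ ba ()

moveResult-source : moveResult c x y x ≡ c x ∸ 2
moveResult-source {x = x} {y = y} with x ≟V x | x ≟V y
... | yes _   | _ = refl
... | no x≢x | _ = ⊥-elim (x≢x refl)

moveResult-target : x ≢ y → moveResult c x y y ≡ suc (c y)
moveResult-target {x = x} {y = y} x≢y with y ≟V x | y ≟V y
... | yes y≡x | _       = ⊥-elim (x≢y (sym y≡x))
... | no _    | yes _   = refl
... | no _    | no y≢y = ⊥-elim (y≢y refl)

moveResult-other : z ≢ x → z ≢ y → moveResult c x y z ≡ c z
moveResult-other {z = z} {x = x} {y = y} z≢x z≢y with z ≟V x | z ≟V y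
... | yes z≡x | _       = ⊥-elim (z≢x z≡x)
... | no _    | yes z≡y = ⊥-elim (z≢y z≡y)
... | no _    | no _    = refl

moveResult-cong : (∀ z → c z ≡ d z) → moveResult c x y z ≡ moveResult d x y z
moveResult-cong {x = x} {y = y} {z = z} c≗d with z ≟V x | z ≟V y
... | yes _ | _     = cong (_∸ 2) (c≗d z)
... | no _  | yes _ = cong suc (c≗d z)
... | no _  | no _  = c≗d z

≤-moveResult-source : Adj x y → 2 + k ≤ c x → k ≤ moveResult c x y x
≤-moveResult-source {y = y} {c = c} _ 2+k≤cx =
  subst (_ ≤_) (sym (moveResult-source {c = c} {y = y})) (∸-monoˡ-≤ 2 2+k≤cx)

≤-moveResult-target : Adj x y → k ≤ c y → suc k ≤ moveResult c x y y
≤-moveResult-target {c = c} adj k≤cy =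
  subst (_ ≤_) (sym (moveResult-target {c = c} (adj≢ adj))) (s≤s k≤cy)

≤-moveResult-other : Adj x y → z ≢ x → z ≢ y → k ≤ c z → k ≤ moveResult c x y z
≤-moveResult-other {c = c} _ z≢x z≢y = subst (_ ≤_) (sym (moveResult-other {c = c} z≢x z≢y))

size-move : Adj x y → 2 ≤ c x → size c ≡ suc (size (moveResult c x y))
size-move {x = x} {y = y} {c = c} adj 2≤cx = +-cancelʳ-≡ (c x ∸ 2 + suc (c y)) _ _ (begin
  size c + (c x ∸ 2 + suc (c y))            ≡⟨ +-assoc (size c) _ _ ⟨
  size c + (c x ∸ 2) + suc (c y)            ≡⟨ cong₂ (λ p q → size c + p + q) left arrived ⟨
  size c + moved x + moved y                ≡⟨ size-update₂ (adj≢ adj) unchanged ⟨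
  size moved + c x + c y                    ≡⟨ cong (λ w → size moved + w + c y) (m+[n∸m]≡n 2≤cx) ⟨
  size moved + (2 + (c x ∸ 2)) + c y        ≡⟨ shuffle (size moved) (c x ∸ 2) (c y) ⟩
  suc (size moved) + (c x ∸ 2 + suc (c y))  ∎)
  where
  open ≡-Reasoning
  moved : Config _
  moved = moveResult c x y
  left : moved x ≡ c x ∸ 2
  left = moveResult-source {c = c} {y = y}
  arrived : moved y ≡ suc (c y)
  arrived = moveResult-target {c = c} (adj≢ adj)
  unchanged : ∀ z → z ≢ x → z ≢ y → moved z ≡ c z
  unchanged z = moveResult-other {c = c}
  shuffle : ∀ s d e → s + (2 + d) + e ≡ suc s + (d + suc e)
  shuffle = solve-∀

size-after-move : Adj x y → 2 ≤ c x → suc k ≤ size c → k ≤ size (moveResult c x y)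
size-after-move adj 2≤cx big = ≤-pred (≤-trans big (≤-reflexive (size-move adj 2≤cx)))

solvable-after : Adj x y → 2 ≤ c x → HubCoverSolvable (moveResult c x y) → HubCoverSolvable c
solvable-after {x = x} {y = y} adj 2≤cx (c′ , c″↝c′ , solution) =
  c′ , (x , y , adj , 2≤cx , λ _ → refl) ◅ c″↝c′ , solution

HubCoverSolvable-cong : (∀ z → c z ≡ d z) → HubCoverSolvable c → HubCoverSolvable d
HubCoverSolvable-cong {d = d} c≗d (_ , ε , U , hub , covered) =
  d , ε , U , hub , λ z z∈U → subst (1 ≤_) (c≗d z) (covered z z∈U)
HubCoverSolvable-cong c≗d (c′ , (x , y , adj , 2≤cx , c₁≗) ◅ c₁↝c′ , solution) =
  c′ , (x , y , adj , subst (2 ≤_) (c≗d x) 2≤cx ,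
        λ z → trans (c₁≗ z) (moveResult-cong {x = x} {y = y} {z = z} c≗d)) ◅ c₁↝c′ ,
  solution

HubPath : (V n → Bool) → V n → V n → Set
HubPath U x y = ∃[ is ] (Path x y is × All (λ z → T (U z)) is)

direct : Adj x y → HubPath U x y
direct e = [] , (edge e , (adj≢ e ∷ []) ∷ [] ∷ []) , []

via : Adj x z → Adj z y → x ≢ y → T (U z) → HubPath U x y
via e₁ e₂ x≢y z∈U =
  _ ∷ [] ,
  (step e₁ (edge e₂) , (x≢y ∷ adj≢ e₁ ∷ []) ∷ (≢-sym (adj≢ e₂) ∷ []) ∷ [] ∷ []) ,
  z∈U ∷ []

via₂ : {w : V n} → Adj x z → Adj z w → Adj w y → x ≢ y → x ≢ w → z ≢ y →
       T (U z) → T (U w) → HubPath U x y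
via₂ e₁ e₂ e₃ x≢y x≢w z≢y z∈U w∈U =
  _ ∷ _ ∷ [] ,
  (step e₁ (step e₂ (edge e₃)) ,
   (x≢y ∷ adj≢ e₁ ∷ x≢w ∷ []) ∷ (≢-sym z≢y ∷ ≢-sym (adj≢ e₃) ∷ []) ∷ (adj≢ e₂ ∷ []) ∷ [] ∷ []) ,
  z∈U ∷ w∈U ∷ []

hubAB hubAU : V n → Bool
hubAB a = true
hubAB b = true
hubAB _ = false
hubAU a     = true
hubAU (u _) = true
hubAU _     = false

hubAB-strong : IsStrongHubSet (hubAB {n})
hubAB-strong = (a , tt) , connect
  where
  connect : ∀ x y → x ≢ y → HubPath hubAB x y
  connect a     a     a≢a = ⊥-elim (a≢a refl)
  connect a     b     _   = direct ab
  connect a     (u i) _   = direct (au i)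
  connect a     (v i) _   = via ab (bv i) (λ ()) tt
  connect b     a     _   = direct ba
  connect b     b     b≢b = ⊥-elim (b≢b refl)
  connect b     (u i) _   = via ba (au i) (λ ()) tt
  connect b     (v i) _   = direct (bv i)
  connect (u i) a     _   = direct (ua i)
  connect (u i) b     _   = via (ua i) ab (λ ()) tt
  connect (u i) (u j) ne  = via (ua i) (au j) ne tt
  connect (u i) (v j) _   = via₂ (ua i) ab (bv j) (λ ()) (λ ()) (λ ()) tt tt
  connect (v i) a     _   = via (vb i) ba (λ ()) tt
  connect (v i) b     _   = direct (vb i)
  connect (v i) (u j) _   = via₂ (vb i) ba (au j) (λ ()) (λ ()) (λ ()) tt tt
  connect (v i) (v j) ne  = via (vb i) (bv j) ne tt

hubAU-strong : IsStrongHubSet (hubAU {n})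
hubAU-strong = (a , tt) , connect
  where
  connect : ∀ x y → x ≢ y → HubPath hubAU x y
  connect a     a     a≢a = ⊥-elim (a≢a refl)
  connect a     b     _   = direct ab
  connect a     (u i) _   = direct (au i)
  connect a     (v i) _   = via (au i) (uv i) (λ ()) tt
  connect b     a     _   = direct ba
  connect b     b     b≢b = ⊥-elim (b≢b refl)
  connect b     (u i) _   = via ba (au i) (λ ()) tt
  connect b     (v i) _   = direct (bv i)
  connect (u i) a     _   = direct (ua i)
  connect (u i) b     _   = via (ua i) ab (λ ()) tt
  connect (u i) (u j) ne  = via (ua i) (au j) ne tt
  connect (u i) (v j) _ with i Fin.≟ j
  ... | yes refl = direct (uv i)
  ... | no i≢j   = via₂ (ua i) (au j) (uv j) (λ ()) (u≢u i≢j) (λ ()) tt tt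
  connect (v i) a     _   = via (vu i) (ua i) (λ ()) tt
  connect (v i) b     _   = direct (vb i)
  connect (v i) (u j) _ with i Fin.≟ j
  ... | yes refl = direct (vu i)
  ... | no i≢j   = via₂ (vu i) (ua i) (au j) (λ ()) (λ ()) (u≢u i≢j) tt tt
  connect (v i) (v j) ne  =
    u i ∷ a ∷ u j ∷ [] ,
    (step (vu i) (step (ua i) (step (au j) (edge (uv j)))) ,
     (ne ∷ (λ ()) ∷ (λ ()) ∷ (λ ()) ∷ []) ∷ ((λ ()) ∷ (λ ()) ∷ (λ ()) ∷ []) ∷
     ((λ ()) ∷ u≢u (ne ∘ cong v) ∷ []) ∷ ((λ ()) ∷ []) ∷ [] ∷ []) ,
    tt ∷ tt ∷ tt ∷ []

entering-u : Adj x (u j) → x ≢ v j → a ≡ x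
entering-u (au _) _    = refl
entering-u (vu _) x≢vj = ⊥-elim (x≢vj refl)

entering-v : Adj x (v j) → x ≢ u j → b ≡ x
entering-v (bv _) _    = refl
entering-v (uv _) x≢uj = ⊥-elim (x≢uj refl)

walk-into-u : {is : List (V n)} → Walk x (u j) is → x ≢ u j → x ≢ v j →
              a ∈ x ∷ is ⊎ (b ∈ x ∷ is × v j ∈ is)
walk-into-u (edge e) _ x≢vj = inj₁ (here (entering-u e x≢vj))
walk-into-u {j = j} (step {z = z} e w) x≢uj x≢vj with z ≟V u j | z ≟V v j
... | yes refl | _        = inj₁ (here (entering-u e x≢vj))
... | no _     | yes refl = inj₂ (here (entering-v e x≢uj) , here refl)
... | no z≢uj  | no z≢vj  = Sum.map there (Product.map there there) (walk-into-u w z≢uj z≢vj)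

∈-tail : x ≢ y → {is : List (V n)} → x ∈ y ∷ is → x ∈ is
∈-tail x≢y (here x≡y) = ⊥-elim (x≢y x≡y)
∈-tail _   (there x∈) = x∈

hub-separates : IsStrongHubSet U → i ≢ j → T (U a) ⊎ (T (U b) × T (U (v j)))
hub-separates {U = U} {i = i} {j = j} (_ , connect) i≢j with connect (u i) (u j) (u≢u i≢j)
... | is , (w , _) , inU =
  Sum.map (lookup ∘ ∈-tail (λ ())) (Product.map (lookup ∘ ∈-tail (λ ())) lookup)
          (walk-into-u w (u≢u i≢j) (λ ()))
  where
  lookup : ∀ {z} → z ∈ is → T (U z)
  lookup = All.lookup inU

-- The symmetry a ↔ b, uᵢ ↔ vᵢ

swap : V n → V n
swap a     = b
swap b     = a
swap (u i) = v i
swap (v i) = u i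

swap-involutive : (x : V n) → swap (swap x) ≡ x
swap-involutive a     = refl
swap-involutive b     = refl
swap-involutive (u _) = refl
swap-involutive (v _) = refl

swap-transpose : z ≡ swap x → swap z ≡ x
swap-transpose {x = x} refl = swap-involutive x

swap-injective : swap x ≡ swap y → x ≡ y
swap-injective {x = x} swapx≡swapy = trans (sym (swap-involutive x)) (swap-transpose swapx≡swapy)

Adj-swap : Adj x y → Adj (swap x) (swap y)
Adj-swap (au i) = bv i
Adj-swap (ua i) = vb i
Adj-swap (bv i) = au i
Adj-swap (vb i) = ua i
Adj-swap (uv i) = vu i
Adj-swap (vu i) = uv i
Adj-swap ab     = ba
Adj-swap ba     = ab

Walk-swap : {is : List (V n)} → Walk x y is → Walk (swap x) (swap y) (map swap is)
Walk-swap (edge e)   = edge (Adj-swap e)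
Walk-swap (step e w) = step (Adj-swap e) (Walk-swap w)

Path-swap : {is : List (V n)} → Path x y is → Path (swap x) (swap y) (map swap is)
Path-swap (w , distinct) = Walk-swap w , Uniqueₚ.map⁺ swap-injective distinct

IsStrongHubSet-swap : IsStrongHubSet U → IsStrongHubSet (U ∘ swap)
IsStrongHubSet-swap {U = U} ((w , w∈U) , connect) =
  (swap w , subst (T ∘ U) (sym (swap-involutive w)) w∈U) , connect′
  where
  connect′ : ∀ x y → x ≢ y → HubPath (U ∘ swap) x y
  connect′ x y x≢y with connect (swap x) (swap y) (x≢y ∘ swap-injective)
  ... | is , path , inU =
    map swap is ,
    subst₂ (λ x′ y′ → Path x′ y′ (map swap is)) (swap-involutive x) (swap-involutive y)
           (Path-swap path) ,
    Allₚ.map⁺ (All.map (λ {z} → subst (T ∘ U) (sym (swap-involutive z))) inU)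

moveResult-swap : (c : Config n) (x y z : V n) →
                  moveResult (c ∘ swap) (swap x) (swap y) z ≡ moveResult c x y (swap z)
moveResult-swap c x y z with z ≟V swap x | swap z ≟V x | z ≟V swap y | swap z ≟V y
... | yes _   | yes _   | _       | _       = refl
... | yes z≡x | no z≢x  | _       | _       = ⊥-elim (z≢x (swap-transpose z≡x))
... | no z≢x  | yes z≡x | _       | _       = ⊥-elim (z≢x (sym (swap-transpose (sym z≡x))))
... | no _    | no _    | yes _   | yes _   = refl
... | no _    | no _    | yes z≡y | no z≢y  = ⊥-elim (z≢y (swap-transpose z≡y))
... | no _    | no _    | no z≢y  | yes z≡y = ⊥-elim (z≢y (sym (swap-transpose (sym z≡y))))
... | no _    | no _    | no _    | no _    = refl

Move-swap : Move c c′ → Move (c ∘ swap) (c′ ∘ swap)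
Move-swap {c = c} (x , y , adj , 2≤cx , c′≗) =
  swap x , swap y , Adj-swap adj , subst (λ w → 2 ≤ c w) (sym (swap-involutive x)) 2≤cx ,
  λ z → trans (c′≗ (swap z)) (sym (moveResult-swap c x y z))

HubCoverSolvable-swap : HubCoverSolvable c → HubCoverSolvable (c ∘ swap)
HubCoverSolvable-swap (c′ , c↝c′ , U , hub , covered) =
  c′ ∘ swap , gmap (_∘ swap) Move-swap c↝c′ , U ∘ swap , IsStrongHubSet-swap hub , covered ∘ swap

solvable-by-symmetry : HubCoverSolvable (c ∘ swap) → HubCoverSolvable c
solvable-by-symmetry {c = c} = HubCoverSolvable-cong (cong c ∘ swap-involutive) ∘ HubCoverSolvable-swap

size-swap : size (c ∘ swap) ≡ size c
size-swap {c = c} = exchange (c a) (c b) (Σu c) (Σv c)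
  where
  exchange : ∀ p q r s → q + p + s + r ≡ p + q + r + s
  exchange = solve-∀

-- Weight functions

weight : ℕ → ℕ → ℕ → ℕ
weight p q k = p * k + q * ⌊ k /2⌋

weight-mono : ∀ p q → k ≤ l → weight p q k ≤ weight p q l
weight-mono p q k≤l = +-mono-≤ (*-monoʳ-≤ p k≤l) (*-monoʳ-≤ q (⌊n/2⌋-mono k≤l))

weight-+2 : ∀ p q k → weight p q (2 + k) ≡ weight p q k + (2 * p + q)
weight-+2 p q k = expand p q k ⌊ k /2⌋
  where
  expand : ∀ p q k h → p * (2 + k) + q * suc h ≡ p * k + q * h + (2 * p + q)
  expand = solve-∀

weight-suc : ∀ p q k → weight p q (suc k) ≤ weight p q k + (p + q)
weight-suc p q k = begin
  p * suc k + q * ⌊ suc k /2⌋  ≤⟨ +-monoʳ-≤ (p * suc k) (*-monoʳ-≤ q (⌊n/2⌋-mono (n≤1+n (suc k)))) ⟩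
  p * suc k + q * suc ⌊ k /2⌋  ≡⟨ expand p q k ⌊ k /2⌋ ⟩
  weight p q k + (p + q)       ∎
  where
  open ≤-Reasoning
  expand : ∀ p q k h → p * suc k + q * suc h ≡ p * k + q * h + (p + q)
  expand = solve-∀

weight-step : p′ + q′ ≤ 2 * p + q →
              weight p q k + weight p′ q′ (suc m) ≤ weight p q (2 + k) + weight p′ q′ m
weight-step {p′ = p′} {q′} {p} {q} {k} {m} gain≤loss = begin
  w k + w′ (suc m)              ≤⟨ +-monoʳ-≤ (w k) (weight-suc p′ q′ m) ⟩
  w k + (w′ m + (p′ + q′))      ≤⟨ +-monoʳ-≤ (w k) (+-monoʳ-≤ (w′ m) gain≤loss) ⟩
  w k + (w′ m + (2 * p + q))    ≡⟨ x∙yz≈xz∙y (w k) (w′ m) _ ⟩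
  w k + (2 * p + q) + w′ m      ≡⟨ cong (_+ w′ m) (weight-+2 p q k) ⟨
  w (2 + k) + w′ m              ∎
  where
  open ≤-Reasoning
  w w′ : ℕ → ℕ
  w  = weight p q
  w′ = weight p′ q′

potential : (α β : V n → ℕ) → Config n → ℕ
potential α β c = size (λ z → weight (α z) (β z) (c z))

Admissible : (α β : V n → ℕ) → Set
Admissible α β = ∀ {x y} → Adj x y → α y + β y ≤ 2 * α x + β x

potential-move : Admissible α β → Move c c′ → potential α β c′ ≤ potential α β c
potential-move {α = α} {β = β} {c = c} {c′ = c′} admissible (x , y , adj , 2≤cx , c′≗) =
  +-cancelʳ-≤ (W x (c x) + W y (c y)) _ _ (begin
    Φ c′ + (W x (c x) + W y (c y))           ≡⟨ +-assoc (Φ c′) _ _ ⟨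
    Φ c′ + W x (c x) + W y (c y)             ≡⟨ size-update₂ (adj≢ adj) unchanged ⟩
    Φ c + W x (c′ x) + W y (c′ y)            ≡⟨ cong₂ (λ p q → Φ c + W x p + W y q) left arrived ⟩
    Φ c + W x (c x ∸ 2) + W y (suc (c y))    ≡⟨ +-assoc (Φ c) _ _ ⟩
    Φ c + (W x (c x ∸ 2) + W y (suc (c y)))  ≤⟨ +-monoʳ-≤ (Φ c) no-gain ⟩
    Φ c + (W x (2 + (c x ∸ 2)) + W y (c y))  ≡⟨ cong (λ k → Φ c + (W x k + W y (c y))) (m+[n∸m]≡n 2≤cx) ⟩
    Φ c + (W x (c x) + W y (c y))            ∎)
  where
  open ≤-Reasoning
  W : V _ → ℕ → ℕ
  W z = weight (α z) (β z)
  Φ : Config _ → ℕ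
  Φ = potential α β
  unchanged : ∀ z → z ≢ x → z ≢ y → W z (c′ z) ≡ W z (c z)
  unchanged z z≢x z≢y = cong (W z) (trans (c′≗ z) (moveResult-other {c = c} z≢x z≢y))
  left : c′ x ≡ c x ∸ 2
  left = trans (c′≗ x) (moveResult-source {c = c} {y = y})
  arrived : c′ y ≡ suc (c y)
  arrived = trans (c′≗ y) (moveResult-target {c = c} (adj≢ adj))
  no-gain : W x (c x ∸ 2) + W y (suc (c y)) ≤ W x (2 + (c x ∸ 2)) + W y (c y)
  no-gain = weight-step {p′ = α y} {β y} {α x} {β x} (admissible adj)

potential-reachable : Admissible α β → Reachable c c′ → potential α β c′ ≤ potential α β c
potential-reachable admissible ε = ≤-refl
potential-reachable {α = α} {β = β} admissible (mv ◅ c↝c′) =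
  ≤-trans (potential-reachable {α = α} {β = β} admissible c↝c′)
          (potential-move {α = α} {β = β} admissible mv)

potential-mono : (∀ z → c z ≤ d z) → potential α β c ≤ potential α β d
potential-mono {α = α} {β = β} c≤d = size-mono (λ z → weight-mono (α z) (β z) (c≤d z))

potential-pair : x ≢ y → 1 ≤ c x → 1 ≤ c y →
                 weight (α x) (β x) 1 + weight (α y) (β y) 1 ≤ potential α β c
potential-pair {x = x} {y = y} {c = c} {α = α} {β = β} x≢y 1≤cx 1≤cy =
  ≤-trans (+-mono-≤ (weight-mono (α x) (β x) 1≤cx) (weight-mono (α y) (β y) 1≤cy))
          (size-pair {F = λ z → weight (α z) (β z) (c z)} x≢y)

-- Upper bound

heavy? : (f : Fin n → ℕ) → (∃[ j ] 2 ≤ f j) ⊎ Light f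
heavy? f with Finₚ.any? (λ j → 2 ≤? f j)
... | yes heavy = inj₁ heavy
... | no ¬heavy = inj₂ λ j → ≮⇒≥ (¬heavy ∘ (j ,_))

size-light : {c : Config n} → c a + c b ≤ k → Light (c ∘ u) → Light (c ∘ v) → size c ≤ k + n + n
size-light ab≤k u≤1 v≤1 = +-mono-≤ (+-mono-≤ ab≤k (sumFin-light u≤1)) (sumFin-light v≤1)

solved-ab : 1 ≤ c a → 1 ≤ c b → HubCoverSolvable c
solved-ab {c = c} 1≤ca 1≤cb = c , ε , hubAB , hubAB-strong , covered
  where
  covered : ∀ z → T (hubAB z) → 1 ≤ c z
  covered a _ = 1≤ca
  covered b _ = 1≤cb

solved-aU : 1 ≤ c a → (∀ i → 1 ≤ c (u i)) → HubCoverSolvable c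
solved-aU {c = c} 1≤ca 1≤cu = c , ε , hubAU , hubAU-strong , covered
  where
  covered : ∀ z → T (hubAU z) → 1 ≤ c z
  covered a     _ = 1≤ca
  covered (u i) _ = 1≤cu i

solved-bV : 1 ≤ c b → (∀ i → 1 ≤ c (v i)) → HubCoverSolvable c
solved-bV 1≤cb 1≤cv = solvable-by-symmetry (solved-aU 1≤cb 1≤cv)

solvable-a≥3 : 3 ≤ c a → HubCoverSolvable c
solvable-a≥3 {c = c} 3≤ca = solvable-after ab (<⇒≤ 3≤ca)
  (solved-ab (≤-moveResult-source {c = c} ab 3≤ca) (≤-moveResult-target {c = c} ab z≤n))

solvable-a≥1-v≥2 : 1 ≤ c a → 2 ≤ c (v j) → HubCoverSolvable c
solvable-a≥1-v≥2 {c = c} {j = j} 1≤ca 2≤cvj = solvable-after (vb j) 2≤cvj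
  (solved-ab (≤-moveResult-other {c = c} (vb j) (λ ()) (λ ()) 1≤ca)
             (≤-moveResult-target {c = c} (vb j) z≤n))

solvable-a=2-light : {c : Config n} → 2 ≤ c a → c a ≤ 2 → c b ≤ 0 →
                     Light (c ∘ u) → Light (c ∘ v) → 1 + (n + n) ≤ size c → HubCoverSolvable c
solvable-a=2-light {n = n} {c = c} 2≤ca ca≤2 cb≤0 u≤1 v≤1 big with n ≤? Σu c
... | yes u-full = solved-aU (<⇒≤ 2≤ca) (sumFin-full u≤1 u-full)
... | no u-gap   = solvable-after ab 2≤ca (solved-bV (≤-moveResult-target {c = c} ab z≤n) v-covered)
  where
  v-full : n ≤ Σv c
  v-full = +-cancelˡ-≤ (suc n) _ _ (begin
    suc n + n        ≤⟨ big ⟩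
    size c           ≤⟨ +-monoˡ-≤ _ (+-monoˡ-≤ _ (+-mono-≤ ca≤2 cb≤0)) ⟩
    2 + Σu c + Σv c  ≤⟨ +-monoˡ-≤ _ (s≤s (≰⇒> u-gap)) ⟩
    suc n + Σv c     ∎)
    where open ≤-Reasoning
  v-covered : ∀ i → 1 ≤ moveResult c a b (v i)
  v-covered i = ≤-moveResult-other {c = c} ab (λ ()) (λ ()) (sumFin-full v≤1 v-full i)

solvable-a≥2 : {c : Config n} → 2 ≤ c a → 1 + (n + n) ≤ size c → HubCoverSolvable c
solvable-a≥2 {c = c} 2≤ca big with 1 ≤? c b | 3 ≤? c a | heavy? (c ∘ v) | heavy? (c ∘ u)
... | yes 1≤cb | _        | _                | _                = solved-ab (<⇒≤ 2≤ca) 1≤cb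
... | no _     | yes 3≤ca | _                | _                = solvable-a≥3 3≤ca
... | no _     | no _     | inj₁ (j , 2≤cvj) | _                = solvable-a≥1-v≥2 (<⇒≤ 2≤ca) 2≤cvj
... | no _     | no _     | inj₂ _           | inj₁ (j , 2≤cuj) =
  solvable-after (ua j) 2≤cuj (solvable-a≥3 (≤-moveResult-target {c = c} (ua j) 2≤ca))
... | no b≱1   | no a≱3   | inj₂ v≤1         | inj₂ u≤1         =
  solvable-a=2-light 2≤ca (≮⇒≥ a≱3) (≮⇒≥ b≱1) u≤1 v≤1 big

solvable-a≥1 : {c : Config n} → 1 ≤ c a → 2 + (n + n) ≤ size c → HubCoverSolvable c
solvable-a≥1 {c = c} 1≤ca big with 1 ≤? c b | 2 ≤? c a | heavy? (c ∘ v) | heavy? (c ∘ u)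
... | yes 1≤cb | _        | _                | _                = solved-ab 1≤ca 1≤cb
... | no _     | yes 2≤ca | _                | _                = solvable-a≥2 2≤ca (≤-trans (n≤1+n _) big)
... | no _     | no _     | inj₁ (j , 2≤cvj) | _                = solvable-a≥1-v≥2 1≤ca 2≤cvj
... | no _     | no _     | inj₂ _           | inj₁ (j , 2≤cuj) =
  solvable-after (ua j) 2≤cuj
    (solvable-a≥2 (≤-moveResult-target {c = c} (ua j) 1≤ca) (size-after-move (ua j) 2≤cuj big))
... | no b≱1   | no a≱2   | inj₂ v≤1         | inj₂ u≤1         =
  ⊥-elim (1+n≰n (≤-trans big (size-light {c = c} (+-mono-≤ (≮⇒≥ a≱2) (≮⇒≥ b≱1)) u≤1 v≤1)))

solvable-b≥1 : {c : Config n} → 1 ≤ c b → 2 + (n + n) ≤ size c → HubCoverSolvable c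
solvable-b≥1 {n = n} {c = c} 1≤cb big =
  solvable-by-symmetry (solvable-a≥1 1≤cb (subst (2 + (n + n) ≤_) (sym (size-swap {c = c})) big))

solvable-3+2n : {c : Config n} → 3 + (n + n) ≤ size c → HubCoverSolvable c
solvable-3+2n {c = c} big with 1 ≤? c a | 1 ≤? c b | heavy? (c ∘ u) | heavy? (c ∘ v)
... | yes 1≤ca | _        | _                | _                = solvable-a≥1 1≤ca (≤-trans (n≤1+n _) big)
... | no _     | yes 1≤cb | _                | _                = solvable-b≥1 1≤cb (≤-trans (n≤1+n _) big)
... | no _     | no _     | inj₁ (j , 2≤cuj) | _                =
  solvable-after (ua j) 2≤cuj
    (solvable-a≥1 (≤-moveResult-target {c = c} (ua j) z≤n) (size-after-move (ua j) 2≤cuj big))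
... | no _     | no _     | inj₂ _           | inj₁ (j , 2≤cvj) =
  solvable-after (vb j) 2≤cvj
    (solvable-b≥1 (≤-moveResult-target {c = c} (vb j) z≤n) (size-after-move (vb j) 2≤cvj big))
... | no a≱1   | no b≱1   | inj₂ u≤1         | inj₂ v≤1         =
  ⊥-elim (1+n≰n (≤-trans (m≤n+m _ 2)
                 (≤-trans big (size-light {c = c} (+-mono-≤ (≮⇒≥ a≱1) (≮⇒≥ b≱1)) u≤1 v≤1))))

-- Lower bound

perPebble perPair : V n → ℕ
perPebble a              = 4
perPebble b              = 2
perPebble (u zero)       = 2
perPebble (v zero)       = 1
perPebble (v (suc zero)) = 4
perPebble _              = 0
perPair (u (suc _))       = 4
perPair (v (suc (suc _))) = 4
perPair _                 = 0

admissible : Admissible (perPebble {n}) perPair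
admissible (au zero)             = ≤ᵇ⇒≤ 2 8 tt
admissible (au (suc _))          = ≤ᵇ⇒≤ 4 8 tt
admissible (ua zero)             = ≤ᵇ⇒≤ 4 4 tt
admissible (ua (suc _))          = ≤ᵇ⇒≤ 4 4 tt
admissible (bv zero)             = ≤ᵇ⇒≤ 1 4 tt
admissible (bv (suc zero))       = ≤ᵇ⇒≤ 4 4 tt
admissible (bv (suc (suc _)))    = ≤ᵇ⇒≤ 4 4 tt
admissible (vb zero)             = ≤ᵇ⇒≤ 2 2 tt
admissible (vb (suc zero))       = ≤ᵇ⇒≤ 2 8 tt
admissible (vb (suc (suc _)))    = ≤ᵇ⇒≤ 2 4 tt
admissible (uv zero)             = ≤ᵇ⇒≤ 1 4 tt
admissible (uv (suc zero))       = ≤ᵇ⇒≤ 4 4 tt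
admissible (uv (suc (suc _)))    = ≤ᵇ⇒≤ 4 4 tt
admissible (vu zero)             = ≤ᵇ⇒≤ 2 2 tt
admissible (vu (suc zero))       = ≤ᵇ⇒≤ 4 8 tt
admissible (vu (suc (suc _)))    = ≤ᵇ⇒≤ 4 4 tt
admissible ab                    = ≤ᵇ⇒≤ 2 8 tt
admissible ba                    = ≤ᵇ⇒≤ 4 4 tt

covered-potential : {c : Config (2 + m)} → IsStrongHubSet U → (∀ z → T (U z) → 1 ≤ c z) →
                    6 ≤ potential perPebble perPair c
covered-potential {c = c} hub covered
  with hub-separates {i = zero} {j = suc zero} hub (λ ())
     | hub-separates {i = suc zero} {j = zero} (IsStrongHubSet-swap hub) (λ ())
... | inj₂ (b∈U , v₁∈U) | _ =
  potential-pair {c = c} {α = perPebble} {β = perPair} (λ ()) (covered b b∈U) (covered _ v₁∈U)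
... | inj₁ a∈U | inj₁ b∈U =
  potential-pair {c = c} {α = perPebble} {β = perPair} (λ ()) (covered a a∈U) (covered b b∈U)
... | inj₁ a∈U | inj₂ (_ , u₀∈U) =
  potential-pair {c = c} {α = perPebble} {β = perPair} (λ ()) (covered a a∈U) (covered _ u₀∈U)

unsolvable : {c : Config (2 + m)} → potential perPebble perPair c ≤ 5 → ¬ HubCoverSolvable c
unsolvable Φ≤5 (c′ , c↝c′ , _ , hub , covered) =
  <⇒≱ (s≤s (≤-trans (potential-reachable {α = perPebble} {β = perPair} admissible c↝c′) Φ≤5))
      (covered-potential hub covered)

crowded : Config (2 + m)
crowded (u (suc _))       = 1
crowded (v zero)          = 5
crowded (v (suc (suc _))) = 1
crowded _                 = 0

size-crowded : size (crowded {m}) ≡ 2 + ((2 + m) + (2 + m))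
size-crowded {m} =
  trans (cong₂ (λ p q → p + (5 + q)) (sumFin-const (suc m) 1) (sumFin-const m 1)) (expand m)
  where
  expand : ∀ m → suc m * 1 + (5 + m * 1) ≡ 2 + ((2 + m) + (2 + m))
  expand = solve-∀

potential-crowded : potential perPebble perPair (crowded {m}) ≡ 5
potential-crowded {m} = cong₂ (λ p q → p + (5 + q)) (vanishes (suc m)) (vanishes m)
  where
  vanishes : ∀ n → sumFin {n} (λ _ → 0) ≡ 0
  vanishes n = trans (sumFin-const n 0) (*-zeroʳ n)

insufficient : 2 ≤ n → t < 3 + (n + n) → ¬ AllSolvable n t
insufficient {n = suc (suc m)} (s≤s (s≤s _)) t<3+2n allSolvable
  with shrink crowded (≤-trans (m<1+n⇒m≤n t<3+2n) (≤-reflexive (sym (size-crowded {m}))))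
... | c , c≤crowded , size≡t = unsolvable Φ≤5 (allSolvable c size≡t)
  where
  Φ≤5 : potential perPebble perPair c ≤ 5
  Φ≤5 = ≤-trans (potential-mono {α = perPebble} {β = perPair} c≤crowded)
                (≤-reflexive (potential-crowded {m}))

2*n+3≡3+[n+n] : ∀ n → 2 * n + 3 ≡ 3 + (n + n)
2*n+3≡3+[n+n] = solve-∀

mainTheorem4 : (n : ℕ) → 2 ≤ n → IsStrongHubCoverPebblingNumberOfBook n (2 * n + 3)
mainTheorem4 n 2≤n rewrite 2*n+3≡3+[n+n] n =
  (λ c size≡ → solvable-3+2n (≤-reflexive (sym size≡))) , λ t t< → insufficient 2≤n t<
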